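{- For every $X\in\mathfrak{W}'$ and every $l\ge1$, $[\lambda(X),L_{z_l}]=XL_{z_l}+L_{x^l}X$ as operators on $\mathfrak{H}^1$.
   Context: $\mathfrak{H}=\mathbb{Q}\langle x,y\rangle$, $\mathfrak{H}^1=\mathbb{Q}+\mathfrak{H}y$, $z_k=x^{k-1}y$, $L_u(w)=uw$. The harmonic product $*$ is the $\mathbb{Q}$-bilinear product on $\mathfrak{H}^1$ with $1*w=w*1=w$ and $z_kw*z_lw'=z_k(w*z_lw')+z_l(z_kw*w')+z_{k+l}(w*w')$; $\mathcal{H}_w(v)=w*v$ for $w,v\in\mathfrak{H}^1$. $\mathfrak{W}$ is the $\mathbb{Q}$-span of $\{\mathcal{H}_w:w\in\mathfrak{H}^1\}$, $\mathfrak{W}'$ the span of $\{L_{z_k}\mathcal{H}_w:k\ge1,w\in\mathfrak{H}^1\}$; the operators $L_{z_k}\mathcal{H}_w$ ($k\ge1$, $w$ a word in $\mathfrak{H}^1$) are linearly independent and $\lambda:\mathfrak{W}'\to\mathfrak{W}$ is the linear map with $\lambda(L_{z_k}\mathcal{H}_w)=\mathcal{H}_{z_kw}$. $[A,B]=AB-BA$. -}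

module Defs where

open import Data.Bool using (Bool; true; false)
open import Data.Nat using (ℕ; zero; suc) renaming (_+_ to _+ℕ_)
open import Data.List using (List; []; _∷_; _++_; map; replicate; concatMap)
open import Data.Product using (_×_; _,_)
open import Data.Rational using (ℚ; 0ℚ; 1ℚ; _+_; _*_; -_)
open import Data.List.Properties using (≡-dec)
import Data.Bool.Properties as BP
open import Relation.Nullary using (yes; no)
open import Relation.Binary.PropositionalEquality using (_≡_)

-- Words in the alphabet {x, y}: false = x, true = y.
Word : Set
Word = List Bool

-- Elements of 𝔥 = ℚ⟨x,y⟩ as finite formal ℚ-linear combinations of words.
Poly : Set
Poly = List (ℚ × Word)

coeff : Poly → Word → ℚ
coeff [] w = 0ℚ
coeff ((c , u) ∷ p) w with ≡-dec BP._≟_ u w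
... | yes _ = c + coeff p w
... | no  _ = coeff p w

infix 4 _≈_
_≈_ : Poly → Poly → Set
p ≈ q = ∀ w → coeff p w ≡ coeff q w

-- Words of 𝔥¹ (words ending in y, or empty) as sequences z_{k₁}…z_{kₙ};
-- the entry n stands for the letter z_{n+1} = x^n y.
ZWord : Set
ZWord = List ℕ

zletter : ℕ → Word
zletter n = replicate n false ++ (true ∷ [])

toWord : ZWord → Word
toWord []      = []
toWord (n ∷ u) = zletter n ++ toWord u

Poly1 : Set
Poly1 = List (ℚ × ZWord)

embed : Poly1 → Poly
embed = map (λ { (c , u) → c , toWord u })

scale : ℚ → Poly1 → Poly1
scale a = map (λ { (c , u) → a * c , u })

Lz : ℕ → Poly1 → Poly1
Lz n = map (λ { (c , u) → c , n ∷ u })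

Lx : ℕ → Poly → Poly
Lx l = map (λ { (c , w) → c , replicate l false ++ w })

-- harmonic product of two words of 𝔥¹ (z_{a+1} * z_{b+1} contributes z_{a+b+2})
hw : ZWord → ZWord → Poly1
hw []      v       = (1ℚ , v) ∷ []
hw (a ∷ u) []      = (1ℚ , a ∷ u) ∷ []
hw (a ∷ u) (b ∷ v) =
  Lz a (hw u (b ∷ v)) ++ Lz b (hw (a ∷ u) v) ++ Lz (suc (a +ℕ b)) (hw u v)

infixl 7 _⊛_
_⊛_ : Poly1 → Poly1 → Poly1
p ⊛ q = concatMap (λ { (c , u) → concatMap (λ { (d , v) → scale (c * d) (hw u v) }) q }) p

ℋ : Poly1 → Poly1 → Poly1
ℋ w v = w ⊛ v

-- Elements of 𝔚' given as formal combinations Σ c · L_{z_{n+1}} ℋ_w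
-- (w a word of 𝔥¹); these operators are linearly independent, so this
-- is a faithful parametrisation of 𝔚'.
W'rep : Set
W'rep = List (ℚ × ℕ × ZWord)

applyW' : W'rep → Poly1 → Poly1
applyW' X v = concatMap (λ { (c , n , w) → scale c (Lz n (ℋ ((1ℚ , w) ∷ []) v)) }) X

-- λ(L_{z_{n+1}} ℋ_w) = ℋ_{z_{n+1} w}, extended linearly; λ(X) = ℋ_{lamWord X}
lamWord : W'rep → Poly1
lamWord = map (λ { (c , n , w) → c , n ∷ w })

applyλ : W'rep → Poly1 → Poly1
applyλ X v = ℋ (lamWord X) v

commutator : (Poly1 → Poly1) → (Poly1 → Poly1) → Poly1 → Poly1
commutator A B v = A (B v) ++ scale (- 1ℚ) (B (A v))

{-# OPTIONS --safe #-}
module Submission where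

open import Defs
open import Data.Bool using (false)
open import Data.Nat using (ℕ; _≤_; _∸_; zero; suc; s≤s; z≤n) renaming (_+_ to _+ℕ_)
import Data.Nat.Properties as ℕ
open import Data.List using (List; []; _∷_; _++_; map; replicate; concatMap)
open import Data.List.Properties using (≡-dec; ++-assoc)
import Data.Bool.Properties as Bool
open import Data.Product using (_×_; _,_; map₁; map₂; uncurry)
open import Data.Rational using (ℚ; 0ℚ; 1ℚ; _+_; _*_; -_)
open import Data.Rational.Properties using (+-identityˡ; +-identityʳ; +-assoc; *-identityˡ; *-identityʳ; *-zeroʳ)
open import Data.Rational.Solver using (module +-*-Solver)
open import Function using (_∘_)
open import Relation.Nullary using (yes; no)
open import Relation.Binary.PropositionalEquality
open ≡-Reasoning
open +-*-Solver

-- Equality in 𝔥 is coefficientwise, and the coefficient of a word t in a combination of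
-- 𝔥¹-words is its pairing with a weight on words, so it suffices to prove the identity after
-- pairing with an arbitrary weight, where both sides are bilinear in X and v. On words the
-- recursion  z_{n+1}w * z_{m+1}v = z_{n+1}(w * z_{m+1}v) + z_{m+1}(z_{n+1}w * v) + z_{n+m+2}(w * v)
-- gives  λ(X)(z_{m+1}v) = X(z_{m+1}v) + z_{m+1}λ(X)(v) + x^{m+1}X(v),  because
-- x^{m+1}z_{n+1} = z_{n+m+2}; subtracting z_{m+1}λ(X)(v) is the commutator formula.

module _ {A : Set} where

  pairing : List (ℚ × A) → (A → ℚ) → ℚ
  pairing []            f = 0ℚ
  pairing ((c , a) ∷ p) f = c * f a + pairing p f

  pairing-++ : ∀ p q (f : A → ℚ) → pairing (p ++ q) f ≡ pairing p f + pairing q f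
  pairing-++ []            q f = sym (+-identityˡ _)
  pairing-++ ((c , a) ∷ p) q f =
    trans (cong (c * f a +_) (pairing-++ p q f)) (sym (+-assoc (c * f a) (pairing p f) (pairing q f)))

  pairing-cong : ∀ p {f g : A → ℚ} → (∀ a → f a ≡ g a) → pairing p f ≡ pairing p g
  pairing-cong []            f≗g = refl
  pairing-cong ((c , a) ∷ p) f≗g = cong₂ (λ x y → c * x + y) (f≗g a) (pairing-cong p f≗g)

  pairing-+ : ∀ p (f g : A → ℚ) → pairing p (λ a → f a + g a) ≡ pairing p f + pairing p g
  pairing-+ []            f g = sym (+-identityˡ 0ℚ)
  pairing-+ ((c , a) ∷ p) f g = begin
    c * (f a + g a) + pairing p (λ a → f a + g a) ≡⟨ cong (c * (f a + g a) +_) (pairing-+ p f g) ⟩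
    c * (f a + g a) + (pairing p f + pairing p g) ≡⟨ interchange c (f a) (g a) (pairing p f) (pairing p g) ⟩
    (c * f a + pairing p f) + (c * g a + pairing p g) ∎
    where
    interchange : ∀ c x y u v → c * (x + y) + (u + v) ≡ (c * x + u) + (c * y + v)
    interchange = solve 5 (λ c x y u v → c :* (x :+ y) :+ (u :+ v) := (c :* x :+ u) :+ (c :* y :+ v)) refl

  pairing-+₃ : ∀ p (f g h : A → ℚ) →
    pairing p (λ a → f a + g a + h a) ≡ pairing p f + pairing p g + pairing p h
  pairing-+₃ p f g h = trans (pairing-+ p (λ a → f a + g a) h) (cong (_+ pairing p h) (pairing-+ p f g))

  pairing-scale : ∀ k p (f : A → ℚ) → pairing (map (map₁ (k *_)) p) f ≡ k * pairing p f
  pairing-scale k []            f = sym (*-zeroʳ k)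
  pairing-scale k ((c , a) ∷ p) f = begin
    k * c * f a + pairing (map (map₁ (k *_)) p) f ≡⟨ cong (k * c * f a +_) (pairing-scale k p f) ⟩
    k * c * f a + k * pairing p f                 ≡⟨ factor k c (f a) (pairing p f) ⟩
    k * (c * f a + pairing p f)                   ∎
    where
    factor : ∀ k c x u → k * c * x + k * u ≡ k * (c * x + u)
    factor = solve 4 (λ k c x u → k :* c :* x :+ k :* u := k :* (c :* x :+ u)) refl

pairing-map₂ : ∀ {A B : Set} (h : A → B) p (f : B → ℚ) → pairing (map (map₂ h) p) f ≡ pairing p (f ∘ h)
pairing-map₂ h []            f = refl
pairing-map₂ h ((c , a) ∷ p) f = cong (c * f (h a) +_) (pairing-map₂ h p f)

pairing-[_] : ∀ {A : Set} a (f : A → ℚ) → pairing ((1ℚ , a) ∷ []) f ≡ f a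
pairing-[ a ] f = trans (+-identityʳ _) (*-identityˡ _)

pairing-⊛ : ∀ p q f → pairing (p ⊛ q) f ≡ pairing p (λ u → pairing q (λ v → pairing (hw u v) f))
pairing-⊛ []            q f = refl
pairing-⊛ ((c , u) ∷ p) q f = begin
  pairing (row q ++ p ⊛ q) f                     ≡⟨ pairing-++ (row q) (p ⊛ q) f ⟩
  pairing (row q) f + pairing (p ⊛ q) f          ≡⟨ cong₂ _+_ (pairing-row q) (pairing-⊛ p q f) ⟩
  c * pairing q H + pairing p (λ u → pairing q (λ v → pairing (hw u v) f)) ∎
  where
  row : Poly1 → Poly1
  row = concatMap (λ { (d , v) → scale (c * d) (hw u v) })
  H : ZWord → ℚ
  H v = pairing (hw u v) f
  pairing-row : ∀ q → pairing (row q) f ≡ c * pairing q H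
  pairing-row []            = sym (*-zeroʳ c)
  pairing-row ((d , v) ∷ q) = begin
    pairing (scale (c * d) (hw u v) ++ row q) f       ≡⟨ pairing-++ (scale (c * d) (hw u v)) (row q) f ⟩
    pairing (scale (c * d) (hw u v)) f + pairing (row q) f
      ≡⟨ cong₂ _+_ (pairing-scale (c * d) (hw u v) f) (pairing-row q) ⟩
    c * d * H v + c * pairing q H                     ≡⟨ factor c d (H v) (pairing q H) ⟩
    c * (d * H v + pairing q H)                       ∎
    where
    factor : ∀ c d x u → c * d * x + c * u ≡ c * (d * x + u)
    factor = solve 4 (λ c d x u → c :* d :* x :+ c :* u := c :* (d :* x :+ u)) refl

pairing-hw-∷ : ∀ n w m v f → pairing (hw (n ∷ w) (m ∷ v)) f ≡
  pairing (hw w (m ∷ v)) (f ∘ (n ∷_)) + pairing (hw (n ∷ w) v) (f ∘ (m ∷_))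
    + pairing (hw w v) (f ∘ (suc (n +ℕ m) ∷_))
pairing-hw-∷ n w m v f = begin
  pairing (Lz n a ++ Lz m b ++ Lz (suc (n +ℕ m)) c) f
    ≡⟨ pairing-++ (Lz n a) _ f ⟩
  pairing (Lz n a) f + pairing (Lz m b ++ Lz (suc (n +ℕ m)) c) f
    ≡⟨ cong (pairing (Lz n a) f +_) (pairing-++ (Lz m b) _ f) ⟩
  pairing (Lz n a) f + (pairing (Lz m b) f + pairing (Lz (suc (n +ℕ m)) c) f)
    ≡⟨ sym (+-assoc (pairing (Lz n a) f) (pairing (Lz m b) f) (pairing (Lz (suc (n +ℕ m)) c) f)) ⟩
  pairing (Lz n a) f + pairing (Lz m b) f + pairing (Lz (suc (n +ℕ m)) c) f
    ≡⟨ cong₂ _+_ (cong₂ _+_ (pairing-map₂ (n ∷_) a f) (pairing-map₂ (m ∷_) b f))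
                 (pairing-map₂ (suc (n +ℕ m) ∷_) c f) ⟩
  pairing a (f ∘ (n ∷_)) + pairing b (f ∘ (m ∷_)) + pairing c (f ∘ (suc (n +ℕ m) ∷_)) ∎
  where
  a = hw w (m ∷ v)
  b = hw (n ∷ w) v
  c = hw w v

pairing-applyλ : ∀ X q f →
  pairing (applyλ X q) f ≡ pairing X (uncurry λ n w → pairing q (λ v → pairing (hw (n ∷ w) v) f))
pairing-applyλ X q f =
  trans (pairing-⊛ (lamWord X) q f) (pairing-map₂ (uncurry _∷_) X _)

pairing-applyW' : ∀ X q f →
  pairing (applyW' X q) f ≡ pairing X (uncurry λ n w → pairing q (λ v → pairing (hw w v) (f ∘ (n ∷_))))
pairing-applyW' []                q f = refl
pairing-applyW' ((c , n , w) ∷ X) q f = begin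
  pairing (scale c (Lz n (ℋ ((1ℚ , w) ∷ []) q)) ++ applyW' X q) f
    ≡⟨ pairing-++ (scale c (Lz n (ℋ ((1ℚ , w) ∷ []) q))) (applyW' X q) f ⟩
  pairing (scale c (Lz n (ℋ ((1ℚ , w) ∷ []) q))) f + pairing (applyW' X q) f
    ≡⟨ cong₂ _+_ (trans (pairing-scale c (Lz n (ℋ ((1ℚ , w) ∷ []) q)) f) (cong (c *_) single)) (pairing-applyW' X q f) ⟩
  c * pairing q (λ v → pairing (hw w v) (f ∘ (n ∷_)))
    + pairing X (uncurry λ n w → pairing q (λ v → pairing (hw w v) (f ∘ (n ∷_)))) ∎
  where
  single : pairing (Lz n (ℋ ((1ℚ , w) ∷ []) q)) f ≡ pairing q (λ v → pairing (hw w v) (f ∘ (n ∷_)))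
  single = begin
    pairing (Lz n (((1ℚ , w) ∷ []) ⊛ q)) f    ≡⟨ pairing-map₂ (n ∷_) (((1ℚ , w) ∷ []) ⊛ q) f ⟩
    pairing (((1ℚ , w) ∷ []) ⊛ q) (f ∘ (n ∷_)) ≡⟨ pairing-⊛ ((1ℚ , w) ∷ []) q (f ∘ (n ∷_)) ⟩
    pairing ((1ℚ , w) ∷ []) G                  ≡⟨ pairing-[ w ] G ⟩
    G w ∎
    where
    G : ZWord → ℚ
    G u = pairing q (λ v → pairing (hw u v) (f ∘ (n ∷_)))

-- f₊ plays the role of f after left multiplication by x^{m+1}.
pairing-applyλ-Lz : ∀ m (f f₊ : ZWord → ℚ) → (∀ n u → f₊ (n ∷ u) ≡ f (suc (n +ℕ m) ∷ u)) → ∀ X v →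
  pairing (applyλ X (Lz m v)) f ≡
    pairing (applyW' X (Lz m v)) f + pairing (applyλ X v) (f ∘ (m ∷_)) + pairing (applyW' X v) f₊
pairing-applyλ-Lz m f f₊ f₊-∷ X v = begin
  pairing (applyλ X (Lz m v)) f
    ≡⟨ pairing-applyλ X (Lz m v) f ⟩
  pairing X (uncurry λ n w → pairing (Lz m v) (λ v′ → pairing (hw (n ∷ w) v′) f))
    ≡⟨ pairing-cong X (uncurry split) ⟩
  pairing X (λ a → uncurry T₁ a + uncurry T₂ a + uncurry T₃ a)
    ≡⟨ pairing-+₃ X (uncurry T₁) (uncurry T₂) (uncurry T₃) ⟩
  pairing X (uncurry T₁) + pairing X (uncurry T₂) + pairing X (uncurry T₃)
    ≡⟨ sym (cong₂ _+_ (cong₂ _+_ (pairing-applyW' X (Lz m v) f) (pairing-applyλ X v (f ∘ (m ∷_))))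
                      (pairing-applyW' X v f₊)) ⟩
  pairing (applyW' X (Lz m v)) f + pairing (applyλ X v) (f ∘ (m ∷_)) + pairing (applyW' X v) f₊ ∎
  where
  T₁ T₂ T₃ : ℕ → ZWord → ℚ
  T₁ n w = pairing (Lz m v) (λ v′ → pairing (hw w v′) (f ∘ (n ∷_)))
  T₂ n w = pairing v (λ v′ → pairing (hw (n ∷ w) v′) (f ∘ (m ∷_)))
  T₃ n w = pairing v (λ v′ → pairing (hw w v′) (f₊ ∘ (n ∷_)))
  split : ∀ n w → pairing (Lz m v) (λ v′ → pairing (hw (n ∷ w) v′) f) ≡ T₁ n w + T₂ n w + T₃ n w
  split n w = begin
    pairing (Lz m v) (λ v′ → pairing (hw (n ∷ w) v′) f)
      ≡⟨ pairing-map₂ (m ∷_) v _ ⟩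
    pairing v (λ v′ → pairing (hw (n ∷ w) (m ∷ v′)) f)
      ≡⟨ pairing-cong v (λ v′ → trans (pairing-hw-∷ n w m v′ f)
                                      (cong (pairing (hw w (m ∷ v′)) (f ∘ (n ∷_)) + pairing (hw (n ∷ w) v′) (f ∘ (m ∷_)) +_)
                                            (pairing-cong (hw w v′) (λ u → sym (f₊-∷ n u))))) ⟩
    pairing v (λ v′ → pairing (hw w (m ∷ v′)) (f ∘ (n ∷_)) + pairing (hw (n ∷ w) v′) (f ∘ (m ∷_))
                        + pairing (hw w v′) (f₊ ∘ (n ∷_)))
      ≡⟨ pairing-+₃ v _ _ _ ⟩
    pairing v (λ v′ → pairing (hw w (m ∷ v′)) (f ∘ (n ∷_))) + T₂ n w + T₃ n w
      ≡⟨ cong (λ x → x + T₂ n w + T₃ n w) (sym (pairing-map₂ (m ∷_) v _)) ⟩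
    T₁ n w + T₂ n w + T₃ n w ∎

δ : Word → Word → ℚ
δ t u with ≡-dec Bool._≟_ u t
... | yes _ = 1ℚ
... | no  _ = 0ℚ

coeff-pairing : ∀ p t → coeff p t ≡ pairing p (δ t)
coeff-pairing []            t = refl
coeff-pairing ((c , u) ∷ p) t with ≡-dec Bool._≟_ u t
... | yes _ = cong₂ _+_ (sym (*-identityʳ c)) (coeff-pairing p t)
... | no  _ = trans (coeff-pairing p t) (sym (trans (cong (_+ pairing p (δ t)) (*-zeroʳ c)) (+-identityˡ _)))

coeff-embed : ∀ p t → coeff (embed p) t ≡ pairing p (δ t ∘ toWord)
coeff-embed p t = trans (coeff-pairing (embed p) t) (pairing-map₂ toWord p (δ t))

replicate-++-zletter : ∀ k n → replicate k false ++ zletter n ≡ zletter (k +ℕ n)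
replicate-++-zletter zero    n = refl
replicate-++-zletter (suc k) n = cong (false ∷_) (replicate-++-zletter k n)

replicate-++-toWord-∷ : ∀ m n u → replicate (suc m) false ++ toWord (n ∷ u) ≡ toWord (suc (n +ℕ m) ∷ u)
replicate-++-toWord-∷ m n u = begin
  replicate (suc m) false ++ (zletter n ++ toWord u) ≡⟨ sym (++-assoc (replicate (suc m) false) (zletter n) (toWord u)) ⟩
  (replicate (suc m) false ++ zletter n) ++ toWord u ≡⟨ cong (_++ toWord u) (replicate-++-zletter (suc m) n) ⟩
  zletter (suc (m +ℕ n)) ++ toWord u                 ≡⟨ cong (λ k → zletter (suc k) ++ toWord u) (ℕ.+-comm m n) ⟩
  zletter (suc (n +ℕ m)) ++ toWord u                 ∎

pairing-commutator-Lz : ∀ (A : Poly1 → Poly1) m v (f : ZWord → ℚ) →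
  pairing (commutator A (Lz m) v) f ≡ pairing (A (Lz m v)) f + - 1ℚ * pairing (A v) (f ∘ (m ∷_))
pairing-commutator-Lz A m v f = begin
  pairing (A (Lz m v) ++ scale (- 1ℚ) (Lz m (A v))) f
    ≡⟨ pairing-++ (A (Lz m v)) (scale (- 1ℚ) (Lz m (A v))) f ⟩
  pairing (A (Lz m v)) f + pairing (scale (- 1ℚ) (Lz m (A v))) f
    ≡⟨ cong (pairing (A (Lz m v)) f +_) (pairing-scale (- 1ℚ) (Lz m (A v)) f) ⟩
  pairing (A (Lz m v)) f + - 1ℚ * pairing (Lz m (A v)) f
    ≡⟨ cong (λ x → pairing (A (Lz m v)) f + - 1ℚ * x) (pairing-map₂ (m ∷_) (A v) f) ⟩
  pairing (A (Lz m v)) f + - 1ℚ * pairing (A v) (f ∘ (m ∷_)) ∎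

coeff-embed-++-Lx : ∀ k p q t → coeff (embed p ++ Lx k (embed q)) t ≡
  pairing p (δ t ∘ toWord) + pairing q (δ t ∘ (replicate k false ++_) ∘ toWord)
coeff-embed-++-Lx k p q t = begin
  coeff (embed p ++ Lx k (embed q)) t
    ≡⟨ coeff-pairing (embed p ++ Lx k (embed q)) t ⟩
  pairing (embed p ++ Lx k (embed q)) (δ t)
    ≡⟨ pairing-++ (embed p) (Lx k (embed q)) (δ t) ⟩
  pairing (embed p) (δ t) + pairing (Lx k (embed q)) (δ t)
    ≡⟨ cong₂ _+_ (pairing-map₂ toWord p (δ t))
                 (trans (pairing-map₂ (replicate k false ++_) (embed q) (δ t))
                        (pairing-map₂ toWord q (δ t ∘ (replicate k false ++_)))) ⟩
  pairing p (δ t ∘ toWord) + pairing q (δ t ∘ (replicate k false ++_) ∘ toWord) ∎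

lemma4p11 : (X : W'rep) (l : ℕ) → 1 ≤ l → (v : Poly1) →
    embed (commutator (applyλ X) (Lz (l ∸ 1)) v)
      ≈ embed (applyW' X (Lz (l ∸ 1) v)) ++ Lx l (embed (applyW' X v))
lemma4p11 X (suc m) (s≤s z≤n) v t = begin
  coeff (embed (commutator (applyλ X) (Lz m) v)) t
    ≡⟨ coeff-embed (commutator (applyλ X) (Lz m) v) t ⟩
  pairing (commutator (applyλ X) (Lz m) v) f
    ≡⟨ pairing-commutator-Lz (applyλ X) m v f ⟩
  pairing (applyλ X (Lz m v)) f + - 1ℚ * B
    ≡⟨ cong (_+ - 1ℚ * B) (pairing-applyλ-Lz m f f₊ (λ n u → cong (δ t) (replicate-++-toWord-∷ m n u)) X v) ⟩
  P + B + Q + - 1ℚ * B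
    ≡⟨ cancel P B Q ⟩
  P + Q
    ≡⟨ sym (coeff-embed-++-Lx (suc m) (applyW' X (Lz m v)) (applyW' X v) t) ⟩
  coeff (embed (applyW' X (Lz m v)) ++ Lx (suc m) (embed (applyW' X v))) t ∎
  where
  f f₊ : ZWord → ℚ
  f  = δ t ∘ toWord
  f₊ = δ t ∘ (replicate (suc m) false ++_) ∘ toWord
  P B Q : ℚ
  P = pairing (applyW' X (Lz m v)) f
  B = pairing (applyλ X v) (f ∘ (m ∷_))
  Q = pairing (applyW' X v) f₊
  cancel : ∀ p b q → p + b + q + - 1ℚ * b ≡ p + q
  cancel = solve 3 (λ p b q → p :+ b :+ q :+ :- con 1ℚ :* b := p :+ q) refl
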